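{- Let $n\in\{3,4,5\}$ and $k\in\{4,5,6\}$. Every theorem of the left-hand logic in each of the following inclusions is a theorem of the right-hand logic: (1) $EL3^-\subseteq EL4^-\subseteq EL5^-$; (2) $ELn^-\subseteq E4Ln^-\subseteq E5Ln^-\subseteq E6Ln^-$; (3) $EkL3^-\subseteq EkL4^-\subseteq EkL5^-$. Moreover, the corresponding inclusions hold for the logics of knowledge: $EL3\subseteq EL4\subseteq EL5$; $ELn\subseteq E4Ln\subseteq E5Ln\subseteq E6Ln$; $EkL3\subseteq EkL4\subseteq EkL5$.
   Context: Formulas $Fm$ are built from an infinite set $V$ of propositional variables using $\bot,\wedge,\vee,\rightarrow$ and unary operators $\square$ and $K$. Abbreviations: $\neg\varphi:=\varphi\rightarrow\bot$, $\top:=\neg\bot$, $\varphi\leftrightarrow\psi:=(\varphi\rightarrow\psi)\wedge(\psi\rightarrow\varphi)$, $\Diamond\varphi:=\neg\square\neg\varphi$. Axiom schemes: (INT) all theorems of intuitionistic propositional logic and their substitution-instances (variables uniformly replaced by arbitrary formulas); (A1) $\square(\varphi\vee\psi)\rightarrow(\square\varphi\vee\square\psi)$; (A2) $\square\varphi\rightarrow\varphi$; (A3) $\square(\varphi\rightarrow\psi)\rightarrow\square(\square\varphi\rightarrow\square\psi)$; (A4) $\square\varphi\rightarrow\square\square\varphi$; (A5) $\neg\square\varphi\rightarrow\square\neg\square\varphi$; (KBel) $K(\varphi\rightarrow\psi)\rightarrow(K\varphi\rightarrow K\psi)$; (CoRe) $\square\varphi\rightarrow\square K\varphi$; (IntRe)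 $K\varphi\rightarrow\neg\neg\varphi$; (E4) $K\varphi\rightarrow KK\varphi$; (E5) $\neg K\varphi\rightarrow K\neg K\varphi$; (PNB) $K\varphi\rightarrow\square K\varphi$; (NNB) $\neg K\varphi\rightarrow\square\neg K\varphi$. Theorem scheme (TND): $\varphi\vee\neg\varphi$. Rules: Modus Ponens (MP); Axiom Necessitation (AN): if $\varphi$ is an axiom of the system (an instance of one of its axiom schemes), infer $\square\varphi$ (AN does not apply to instances of (TND) or other theorems). $\Phi\vdash_{\mathcal L}\varphi$ means there is a finite sequence ending in $\varphi$ each member of which is an axiom of $\mathcal L$, a member of $\Phi$, an instance of (TND), a formula $\square\psi$ with $\psi$ an axiom of $\mathcal L$, or follows from two earlier members by MP. Systems: $L3$ has axiom schemes (INT),(A1),(A2),(A3), theorem scheme (TND), rules MP, AN; $L4=L3+$(A4); $L5=L4+$(A5). Over the full language: $EL3^-=L3+$(KBel)$+$(CoRe), $EL4^-=EL3^-+$(A4), $EL5^-=EL4^-+$(A5); for $n\in\{3,4,5\}$: $E4Ln^-=ELn^-+$(E4), $E5Ln^-=E4Ln^-+$(E5), $E6Ln^-=ELn^-+$(PNB)$+$(NNB), $ELn=ELn^-+$(IntRe), and $EkLn=EkLn^-+$(IntRe) for $k\in\{4,5,6\}$ (added schemes are axiom schemes, so AN applies to them). -}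

module Defs where

open import Data.Nat using (ℕ)
open import Data.Product using (Σ; ∃; _×_; _,_)
open import Data.List using (List; []; _∷_; _++_)
open import Data.List.Membership.Propositional using (_∈_)
open import Data.Empty using (⊥)
open import Relation.Binary.PropositionalEquality using (_≡_)

infixr 5 _⇒_
infixr 6 _∨_
infixr 7 _∧_

data Fm : Set where
  var : ℕ → Fm
  ⊥'  : Fm
  _∧_ : Fm → Fm → Fm
  _∨_ : Fm → Fm → Fm
  _⇒_ : Fm → Fm → Fm
  □   : Fm → Fm
  K   : Fm → Fm

¬' : Fm → Fm
¬' φ = φ ⇒ ⊥'

⊤' : Fm
⊤' = ¬' ⊥'

_⇔_ : Fm → Fm → Fm
φ ⇔ ψ = (φ ⇒ ψ) ∧ (ψ ⇒ φ)

◇ : Fm → Fm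
◇ φ = ¬' (□ (¬' φ))

data PFm : Set where
  pvar : ℕ → PFm
  p⊥   : PFm
  _p∧_ : PFm → PFm → PFm
  _p∨_ : PFm → PFm → PFm
  _p⇒_ : PFm → PFm → PFm

infixr 5 _p⇒_
infixr 6 _p∨_
infixr 7 _p∧_

data IPC : PFm → Set where
  ipc-K   : ∀ {a b}   → IPC (a p⇒ b p⇒ a)
  ipc-S   : ∀ {a b c} → IPC ((a p⇒ b p⇒ c) p⇒ (a p⇒ b) p⇒ a p⇒ c)
  ipc-∧I  : ∀ {a b}   → IPC (a p⇒ b p⇒ a p∧ b)
  ipc-∧E₁ : ∀ {a b}   → IPC (a p∧ b p⇒ a)
  ipc-∧E₂ : ∀ {a b}   → IPC (a p∧ b p⇒ b)
  ipc-∨I₁ : ∀ {a b}   → IPC (a p⇒ a p∨ b)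
  ipc-∨I₂ : ∀ {a b}   → IPC (b p⇒ a p∨ b)
  ipc-∨E  : ∀ {a b c} → IPC ((a p⇒ c) p⇒ (b p⇒ c) p⇒ a p∨ b p⇒ c)
  ipc-efq : ∀ {a}     → IPC (p⊥ p⇒ a)
  ipc-mp  : ∀ {a b}   → IPC (a p⇒ b) → IPC a → IPC b

subst : (ℕ → Fm) → PFm → Fm
subst σ (pvar x)  = σ x
subst σ p⊥        = ⊥'
subst σ (a p∧ b)  = subst σ a ∧ subst σ b
subst σ (a p∨ b)  = subst σ a ∨ subst σ b
subst σ (a p⇒ b)  = subst σ a ⇒ subst σ b

data Scheme : Set where
  INT A1 A2 A3 A4 A5 KBel CoRe IntRe E4 E5 PNB NNB : Scheme

Inst : Scheme → Fm → Set
Inst INT   φ = Σ PFm λ ψ → Σ (ℕ → Fm) λ σ → IPC ψ × subst σ ψ ≡ φ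
Inst A1    φ = ∃ λ a → ∃ λ b → φ ≡ (□ (a ∨ b) ⇒ (□ a ∨ □ b))
Inst A2    φ = ∃ λ a → φ ≡ (□ a ⇒ a)
Inst A3    φ = ∃ λ a → ∃ λ b → φ ≡ (□ (a ⇒ b) ⇒ □ (□ a ⇒ □ b))
Inst A4    φ = ∃ λ a → φ ≡ (□ a ⇒ □ (□ a))
Inst A5    φ = ∃ λ a → φ ≡ (¬' (□ a) ⇒ □ (¬' (□ a)))
Inst KBel  φ = ∃ λ a → ∃ λ b → φ ≡ (K (a ⇒ b) ⇒ (K a ⇒ K b))
Inst CoRe  φ = ∃ λ a → φ ≡ (□ a ⇒ □ (K a))
Inst IntRe φ = ∃ λ a → φ ≡ (K a ⇒ ¬' (¬' a))
Inst E4    φ = ∃ λ a → φ ≡ (K a ⇒ K (K a))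
Inst E5    φ = ∃ λ a → φ ≡ (¬' (K a) ⇒ K (¬' (K a)))
Inst PNB   φ = ∃ λ a → φ ≡ (K a ⇒ □ (K a))
Inst NNB   φ = ∃ λ a → φ ≡ (¬' (K a) ⇒ □ (¬' (K a)))

-- A logic is given by its list of axiom schemes; rules are MP and AN,
-- and (TND) is available as a theorem scheme (not subject to AN).
Logic : Set
Logic = List Scheme

Axiom : Logic → Fm → Set
Axiom L φ = Σ Scheme λ s → s ∈ L × Inst s φ

data Deriv (L : Logic) (Φ : Fm → Set) : Fm → Set where
  d-ax  : ∀ {φ} → Axiom L φ → Deriv L Φ φ
  d-hyp : ∀ {φ} → Φ φ → Deriv L Φ φ
  d-tnd : ∀ {φ} → Deriv L Φ (φ ∨ ¬' φ)
  d-an  : ∀ {φ} → Axiom L φ → Deriv L Φ (□ φ)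
  d-mp  : ∀ {φ ψ} → Deriv L Φ (φ ⇒ ψ) → Deriv L Φ φ → Deriv L Φ ψ

Thm : Logic → Fm → Set
Thm L φ = Deriv L (λ _ → ⊥) φ

_⊆L_ : Logic → Logic → Set
L₁ ⊆L L₂ = ∀ φ → Thm L₁ φ → Thm L₂ φ

data N : Set where n3 n4 n5 : N
data Kx : Set where k4 k5 k6 : Kx

L3 : Logic
L3 = INT ∷ A1 ∷ A2 ∷ A3 ∷ []

EL3⁻ EL4⁻ EL5⁻ : Logic
EL3⁻ = L3 ++ (KBel ∷ CoRe ∷ [])
EL4⁻ = EL3⁻ ++ (A4 ∷ [])
EL5⁻ = EL4⁻ ++ (A5 ∷ [])

EL⁻ : N → Logic
EL⁻ n3 = EL3⁻
EL⁻ n4 = EL4⁻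
EL⁻ n5 = EL5⁻

E4L⁻ E5L⁻ E6L⁻ : N → Logic
E4L⁻ n = EL⁻ n ++ (E4 ∷ [])
E5L⁻ n = E4L⁻ n ++ (E5 ∷ [])
E6L⁻ n = EL⁻ n ++ (PNB ∷ NNB ∷ [])

EkL⁻ : Kx → N → Logic
EkL⁻ k4 = E4L⁻
EkL⁻ k5 = E5L⁻
EkL⁻ k6 = E6L⁻

EL E4L E5L E6L : N → Logic
EL  n = EL⁻ n ++ (IntRe ∷ [])
E4L n = E4L⁻ n ++ (IntRe ∷ [])
E5L n = E5L⁻ n ++ (IntRe ∷ [])
E6L n = E6L⁻ n ++ (IntRe ∷ [])

EkL : Kx → N → Logic
EkL k n = EkL⁻ k n ++ (IntRe ∷ [])

-- Adding axiom schemes only enlarges the set of theorems, so all inclusions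
-- but E5Ln⁻ ⊆ E6Ln⁻ are immediate.  For that one, (E4) and (E5) are derivable
-- from (PNB) and (NNB): Kφ → □Kφ → □KKφ → KKφ by (PNB), (CoRe), (A2), and
-- likewise for ¬Kφ.  Since (AN) may also be applied to (E4) and (E5) in
-- E5Ln⁻, their necessitations must be derived too, which works because every
-- axiom used in those derivations may itself be necessitated.
module Submission where

open import Defs
open import Data.Nat using (ℕ)
open import Data.Product using (_×_; _,_; proj₁; proj₂; map)
open import Data.Sum using (inj₁; inj₂)
open import Data.List using (List; []; _∷_; _++_)
open import Data.List.Membership.Propositional using (_∈_)
open import Data.List.Membership.Propositional.Properties using (∈-++⁻; ∈-++⁺ʳ)
open import Data.List.Relation.Unary.Any using (here; there)
open import Data.List.Relation.Binary.Subset.Propositional using (_⊆_)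
open import Data.List.Relation.Binary.Subset.Propositional.Properties
  using (⊆-trans; xs⊆xs++ys; ++⁺ˡ)
open import Function using (_∘_)
open import Relation.Binary.PropositionalEquality using (refl)

Deriv-mono : ∀ {L₁ L₂ Φ φ} → L₁ ⊆ L₂ → Deriv L₁ Φ φ → Deriv L₂ Φ φ
Deriv-mono L₁⊆L₂ (d-ax (s , s∈L₁ , i)) = d-ax (s , L₁⊆L₂ s∈L₁ , i)
Deriv-mono L₁⊆L₂ (d-hyp h)             = d-hyp h
Deriv-mono L₁⊆L₂ d-tnd                 = d-tnd
Deriv-mono L₁⊆L₂ (d-an (s , s∈L₁ , i)) = d-an (s , L₁⊆L₂ s∈L₁ , i)
Deriv-mono L₁⊆L₂ (d-mp d e)            = d-mp (Deriv-mono L₁⊆L₂ d) (Deriv-mono L₁⊆L₂ e)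

Thm□ : Logic → Fm → Set
Thm□ L φ = Thm L φ × Thm L (□ φ)

axiom□ : ∀ {L s φ} → s ∈ L → Inst s φ → Thm□ L φ
axiom□ s∈L i = d-ax (_ , s∈L , i) , d-an (_ , s∈L , i)

-- Inclusion of theorems is not preserved by adding axiom schemes to both
-- sides, because (AN) applies to axioms only; this stronger relation is.
_⊑_ : Logic → Logic → Set
L₁ ⊑ L₂ = ∀ {s φ} → s ∈ L₁ → Inst s φ → Thm□ L₂ φ

⊑⇒⊆L : ∀ {L₁ L₂} → L₁ ⊑ L₂ → L₁ ⊆L L₂
⊑⇒⊆L L₁⊑L₂ _ (d-ax (s , s∈L₁ , i)) = proj₁ (L₁⊑L₂ s∈L₁ i)
⊑⇒⊆L L₁⊑L₂ _ d-tnd                 = d-tnd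
⊑⇒⊆L L₁⊑L₂ _ (d-an (s , s∈L₁ , i)) = proj₂ (L₁⊑L₂ s∈L₁ i)
⊑⇒⊆L L₁⊑L₂ _ (d-mp d e)            = d-mp (⊑⇒⊆L L₁⊑L₂ _ d) (⊑⇒⊆L L₁⊑L₂ _ e)

⊆⇒⊑ : ∀ {L₁ L₂} → L₁ ⊆ L₂ → L₁ ⊑ L₂
⊆⇒⊑ L₁⊆L₂ = axiom□ ∘ L₁⊆L₂

⊑-++ : ∀ {L₁ L₂} ext → L₁ ⊑ L₂ → (L₁ ++ ext) ⊑ (L₂ ++ ext)
⊑-++ {L₁} {L₂} ext L₁⊑L₂ s∈L₁++ext i with ∈-++⁻ L₁ s∈L₁++ext
... | inj₁ s∈L₁  = map (Deriv-mono (xs⊆xs++ys L₂ ext)) (Deriv-mono (xs⊆xs++ys L₂ ext)) (L₁⊑L₂ s∈L₁ i)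
... | inj₂ s∈ext = axiom□ (∈-++⁺ʳ L₂ s∈ext) i

module Introspection
  {L : Logic} (INT∈L : INT ∈ L) (A2∈L : A2 ∈ L) (A3∈L : A3 ∈ L) (CoRe∈L : CoRe ∈ L)
  where

  private
    syllogism : PFm
    syllogism = (pvar 1 p⇒ pvar 2) p⇒ (pvar 0 p⇒ pvar 1) p⇒ (pvar 0 p⇒ pvar 2)

    -- the combinator B = S (K S) K
    ipc-syllogism : IPC syllogism
    ipc-syllogism = ipc-mp (ipc-mp ipc-S (ipc-mp ipc-K ipc-S)) ipc-K

    syllogism-at : Fm → Fm → Fm → ℕ → Fm
    syllogism-at a b c 0 = a
    syllogism-at a b c 1 = b
    syllogism-at a b c _ = c

    □-mp : ∀ {a b} → Thm L (□ (a ⇒ b)) → Thm L (□ a) → Thm L (□ b)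
    □-mp {a} {b} □a⇒b □a =
      d-mp (d-mp (d-ax (A2 , A2∈L , _ , refl)) (d-mp (d-ax (A3 , A3∈L , a , b , refl)) □a⇒b)) □a

  ⇒-trans□ : ∀ {a b c} → Thm□ L (a ⇒ b) → Thm□ L (b ⇒ c) → Thm□ L (a ⇒ c)
  ⇒-trans□ {a} {b} {c} (a⇒b , □a⇒b) (b⇒c , □b⇒c) =
    d-mp (d-mp (proj₁ syl) b⇒c) a⇒b , □-mp (□-mp (proj₂ syl) □b⇒c) □a⇒b
    where
      syl = axiom□ INT∈L (syllogism , syllogism-at a b c , ipc-syllogism , refl)

  □⇒K : ∀ {φ ψ} → Thm□ L (φ ⇒ □ ψ) → Thm□ L (φ ⇒ K ψ)
  □⇒K {ψ = ψ} φ⇒□ψ =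
    ⇒-trans□ (⇒-trans□ φ⇒□ψ (axiom□ CoRe∈L (ψ , refl))) (axiom□ A2∈L (K ψ , refl))

  E4-from-PNB : ∀ {φ} → PNB ∈ L → Inst E4 φ → Thm□ L φ
  E4-from-PNB PNB∈L (a , refl) = □⇒K (axiom□ PNB∈L (a , refl))

  E5-from-NNB : ∀ {φ} → NNB ∈ L → Inst E5 φ → Thm□ L φ
  E5-from-NNB NNB∈L (a , refl) = □⇒K (axiom□ NNB∈L (a , refl))

EL3⁻⊆EL⁻ : ∀ n → EL3⁻ ⊆ EL⁻ n
EL3⁻⊆EL⁻ n3 = λ s∈ → s∈
EL3⁻⊆EL⁻ n4 = xs⊆xs++ys EL3⁻ _
EL3⁻⊆EL⁻ n5 = ⊆-trans (xs⊆xs++ys EL3⁻ _) (xs⊆xs++ys EL4⁻ _)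

EkL⁻-mono : ∀ k {m n} → EL⁻ m ⊆ EL⁻ n → EkL⁻ k m ⊆ EkL⁻ k n
EkL⁻-mono k4 m⊆n = ++⁺ˡ _ m⊆n
EkL⁻-mono k5 m⊆n = ++⁺ˡ _ (++⁺ˡ _ m⊆n)
EkL⁻-mono k6 m⊆n = ++⁺ˡ _ m⊆n

module _ (n : N) where

  private
    EL⁻⊆E6L⁻ : EL⁻ n ⊆ E6L⁻ n
    EL⁻⊆E6L⁻ = xs⊆xs++ys (EL⁻ n) _

    EL3⁻⊆E6L⁻ : EL3⁻ ⊆ E6L⁻ n
    EL3⁻⊆E6L⁻ = ⊆-trans (EL3⁻⊆EL⁻ n) EL⁻⊆E6L⁻

  open Introspection
    (EL3⁻⊆E6L⁻ (here refl))
    (EL3⁻⊆E6L⁻ (there (there (here refl))))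
    (EL3⁻⊆E6L⁻ (there (there (there (here refl)))))
    (EL3⁻⊆E6L⁻ (there (there (there (there (there (here refl)))))))

  E5L⁻⊑E6L⁻ : E5L⁻ n ⊑ E6L⁻ n
  E5L⁻⊑E6L⁻ s∈E5L⁻ i with ∈-++⁻ (E4L⁻ n) s∈E5L⁻
  ... | inj₂ (here refl) = E5-from-NNB (∈-++⁺ʳ (EL⁻ n) (there (here refl))) i
  ... | inj₁ s∈E4L⁻ with ∈-++⁻ (EL⁻ n) s∈E4L⁻
  ...   | inj₁ s∈EL⁻       = axiom□ (EL⁻⊆E6L⁻ s∈EL⁻) i
  ...   | inj₂ (here refl) = E4-from-PNB (∈-++⁺ʳ (EL⁻ n) (here refl)) i

lemma3p1 : (n : N) → (k : Kx) →
    ((EL⁻ n3 ⊆L EL⁻ n4) × (EL⁻ n4 ⊆L EL⁻ n5)) ×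
    ((EL⁻ n ⊆L E4L⁻ n) × (E4L⁻ n ⊆L E5L⁻ n) × (E5L⁻ n ⊆L E6L⁻ n)) ×
    ((EkL⁻ k n3 ⊆L EkL⁻ k n4) × (EkL⁻ k n4 ⊆L EkL⁻ k n5)) ×
    ((EL n3 ⊆L EL n4) × (EL n4 ⊆L EL n5)) ×
    ((EL n ⊆L E4L n) × (E4L n ⊆L E5L n) × (E5L n ⊆L E6L n)) ×
    ((EkL k n3 ⊆L EkL k n4) × (EkL k n4 ⊆L EkL k n5))
lemma3p1 n k =
  (⊑⇒⊆L EL3⁻⊑EL4⁻ , ⊑⇒⊆L EL4⁻⊑EL5⁻) ,
  (⊑⇒⊆L EL⁻⊑E4L⁻ , ⊑⇒⊆L E4L⁻⊑E5L⁻ , ⊑⇒⊆L (E5L⁻⊑E6L⁻ n)) ,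
  (⊑⇒⊆L EkL3⁻⊑EkL4⁻ , ⊑⇒⊆L EkL4⁻⊑EkL5⁻) ,
  (withIntRe EL3⁻⊑EL4⁻ , withIntRe EL4⁻⊑EL5⁻) ,
  (withIntRe EL⁻⊑E4L⁻ , withIntRe E4L⁻⊑E5L⁻ , withIntRe (E5L⁻⊑E6L⁻ n)) ,
  (withIntRe EkL3⁻⊑EkL4⁻ , withIntRe EkL4⁻⊑EkL5⁻)
  where
    withIntRe : ∀ {L₁ L₂} → L₁ ⊑ L₂ → (L₁ ++ IntRe ∷ []) ⊆L (L₂ ++ IntRe ∷ [])
    withIntRe = ⊑⇒⊆L ∘ ⊑-++ (IntRe ∷ [])

    EL3⁻⊑EL4⁻ : EL⁻ n3 ⊑ EL⁻ n4
    EL3⁻⊑EL4⁻ = ⊆⇒⊑ (xs⊆xs++ys EL3⁻ _)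

    EL4⁻⊑EL5⁻ : EL⁻ n4 ⊑ EL⁻ n5
    EL4⁻⊑EL5⁻ = ⊆⇒⊑ (xs⊆xs++ys EL4⁻ _)

    EL⁻⊑E4L⁻ : EL⁻ n ⊑ E4L⁻ n
    EL⁻⊑E4L⁻ = ⊆⇒⊑ (xs⊆xs++ys (EL⁻ n) _)

    E4L⁻⊑E5L⁻ : E4L⁻ n ⊑ E5L⁻ n
    E4L⁻⊑E5L⁻ = ⊆⇒⊑ (xs⊆xs++ys (E4L⁻ n) _)

    EkL3⁻⊑EkL4⁻ : EkL⁻ k n3 ⊑ EkL⁻ k n4
    EkL3⁻⊑EkL4⁻ = ⊆⇒⊑ (EkL⁻-mono k (xs⊆xs++ys EL3⁻ _))

    EkL4⁻⊑EkL5⁻ : EkL⁻ k n4 ⊑ EkL⁻ k n5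
    EkL4⁻⊑EkL5⁻ = ⊆⇒⊑ (EkL⁻-mono k (xs⊆xs++ys EL4⁻ _))
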